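{- Let $T$ be a tree rooted in a vertex $r$, $\tau$ a threshold function for $T$, $u$ a vertex of $T$ and $b$ a non-negative integer. Then $y_0(u,b)\geq y_1(u,b)$. Moreover, if $y_0(u,b)=y_1(u,b)$ and $b\leq n(T_u)-1$, then there is a set $Y\subseteq V(T_u)\setminus\{u\}$ with $|Y|=b$ such that simultaneously ${\rm dyn}(T_u-Y,\tau)=y_0(u,b)$ and ${\rm dyn}(T_u-Y,\tau^u)=y_1(u,b)$.
   Context: A threshold function for a graph $G$ is a function $\tau:U\to\mathbb{Z}\cup\{\infty\}$ whose domain $U$ contains $V(G)$. For $D\subseteq V(G)$, the hull $H_{(G,\tau)}(D)$ is the smallest $H\subseteq V(G)$ with $D\subseteq H$ and $u\in H$ for every vertex $u$ with $|H\cap N_G(u)|\geq\tau(u)$; $D$ is a dynamic monopoly if $H_{(G,\tau)}(D)=V(G)$; ${\rm dyn}(G,\tau)$ is the minimum order of a dynamic monopoly. For a vertex $u$, $\tau^u$ equals $\tau$ except $\tau^u(u)=\tau(u)-1$. $T_u$ is the subtree of $T$ induced by $u$ and its descendants, $n(T_u)$ its order. Define $y_0(u,b)=\max\{{\rm dyn}(T_u-Y,\tau):Y\subseteq V(T_u),|Y|=b,u\notin Y\}$ and $y_1(u,b)=\max\{{\rm dyn}(T_u-Y,\tau^u):Y\subseteq V(T_u),|Y|=b,u\notin Y\}$, with $\max\emptyset=-\infty$. -}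

module Defs where

open import Data.Bool using (Bool; T; true; false)
open import Data.Nat using (ℕ; _≤_; _∸_)
open import Data.Integer using (ℤ; +_) renaming (_≤_ to _≤ℤ_; _-_ to _-ℤ_)
open import Data.Fin using (Fin)
open import Data.Fin.Subset using (Subset; _∈_; _∉_; _⊆_; _∩_; ∁; ∣_∣)
open import Data.Vec using (tabulate)
open import Data.List using (List; []; _∷_; head; last; length)
open import Data.List.Relation.Unary.Linked using (Linked)
open import Data.List.Relation.Unary.Unique.Propositional using (Unique)
import Data.List.Membership.Propositional as LM
open import Data.Maybe using (Maybe; just; nothing)
open import Data.Product using (Σ; ∃; _×_)
open import Data.Empty using (⊥)
open import Data.Unit using (⊤)
open import Relation.Binary.PropositionalEquality using (_≡_; _≢_)
open import Relation.Nullary using (¬_)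

data ℤ∞ : Set where
  fin : ℤ → ℤ∞
  ∞   : ℤ∞

_≥∞_ : ℕ → ℤ∞ → Set
m ≥∞ fin z = z ≤ℤ + m
m ≥∞ ∞     = ⊥

-- Max over a possibly empty family: nothing = -∞
_≤⊥_ : Maybe ℕ → Maybe ℕ → Set
nothing ≤⊥ _      = ⊤
just a  ≤⊥ nothing = ⊥
just a  ≤⊥ just b  = a ≤ b

module _ {n : ℕ} (adj : Fin n → Fin n → Bool) where

  E : Fin n → Fin n → Set
  E v w = T (adj v w)

  N : Fin n → Subset n
  N v = tabulate (adj v)

  IsPath : Fin n → Fin n → List (Fin n) → Set
  IsPath a b xs = Linked E xs × Unique xs × head xs ≡ just a × last xs ≡ just b

  IsCycle : List (Fin n) → Set
  IsCycle [] = ⊥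
  IsCycle (x ∷ []) = ⊥
  IsCycle (x ∷ y ∷ []) = ⊥
  IsCycle (x ∷ y ∷ z ∷ rest) =
    Linked E (x ∷ y ∷ z ∷ rest) × Unique (x ∷ y ∷ z ∷ rest) ×
    Σ (Fin n) (λ l → last (z ∷ rest) ≡ just l × E l x)

  IsTree : Set
  IsTree = (∀ v w → adj v w ≡ adj w v) × (∀ v → adj v v ≡ false)
         × (∀ v w → ∃ λ xs → IsPath v w xs)
         × (∀ xs → ¬ IsCycle xs)

  IsDescendant : Fin n → Fin n → Fin n → Set
  IsDescendant r u w = ∃ λ xs → IsPath r w xs × LM._∈_ u xs

  IsSubtreeVertexSet : Fin n → Fin n → Subset n → Set
  IsSubtreeVertexSet r u Su = ∀ w → (w ∈ Su → IsDescendant r u w) × (IsDescendant r u w → w ∈ Su)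

  -- Everything below concerns the induced subgraph G[S] with vertex set S.
  -- H is closed w.r.t. (G[S], τ) and contains D
  IsClosed : Subset n → (Fin n → ℤ∞) → Subset n → Subset n → Set
  IsClosed S τ D H = H ⊆ S × D ⊆ H ×
    (∀ v → v ∈ S → ∣ H ∩ (N v ∩ S) ∣ ≥∞ τ v → v ∈ H)

  InHull : Subset n → (Fin n → ℤ∞) → Subset n → Fin n → Set
  InHull S τ D v = v ∈ S × (∀ H → IsClosed S τ D H → v ∈ H)

  IsDynMonopoly : Subset n → (Fin n → ℤ∞) → Subset n → Set
  IsDynMonopoly S τ D = D ⊆ S × (∀ v → v ∈ S → InHull S τ D v)

  IsDyn : Subset n → (Fin n → ℤ∞) → ℕ → Set
  IsDyn S τ k = (∃ λ D → IsDynMonopoly S τ D × ∣ D ∣ ≡ k)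
              × (∀ D → IsDynMonopoly S τ D → k ≤ ∣ D ∣)

  Admissible : Subset n → Fin n → ℕ → Subset n → Set
  Admissible Su u b Y = Y ⊆ Su × ∣ Y ∣ ≡ b × u ∉ Y

  IsYMax : Subset n → Fin n → ℕ → (Fin n → ℤ∞) → Maybe ℕ → Set
  IsYMax Su u b τ nothing = ∀ Y → ¬ Admissible Su u b Y
  IsYMax Su u b τ (just m) =
    (∃ λ Y → Admissible Su u b Y × IsDyn (Su ∩ ∁ Y) τ m)
    × (∀ Y k → Admissible Su u b Y → IsDyn (Su ∩ ∁ Y) τ k → k ≤ m)

open import Data.Fin using (_≟_)
open import Relation.Nullary using (yes; no)

dec∞ : ℤ∞ → ℤ∞
dec∞ (fin z) = fin (z -ℤ + 1)
dec∞ ∞ = ∞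

lower : {n : ℕ} → (Fin n → ℤ∞) → Fin n → (Fin n → ℤ∞)
lower τ u v with v ≟ u
... | yes _ = dec∞ (τ v)
... | no _  = τ v

-- Lowering thresholds makes fewer sets closed and hence hulls larger, so every
-- dynamic monopoly for τ is one for τ^u, and dyn(T_u - Y, τ^u) ≤ dyn(T_u - Y, τ) for every Y.
-- Taking maxima gives y₁ ≤ y₀.  If y₀ = y₁, a set Y attaining y₁ is squeezed:
-- y₁ = dyn(T_u - Y, τ^u) ≤ dyn(T_u - Y, τ) ≤ y₀ = y₁, so the same Y attains y₀.
-- The bound b ≤ n(T_u) - 1 only serves to exclude the case y₀ = y₁ = -∞.
module Submission where

open import Defs
open import Data.Bool using (Bool)
open import Data.Nat using (ℕ; zero; suc; _≤_; _<_; _∸_; z≤n; s≤s; _<?_)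
open import Data.Nat.Induction using (<-wellFounded)
import Data.Nat.Properties as ℕ
import Data.Integer as ℤ
import Data.Integer.Properties as ℤ
open import Data.Fin using (Fin; _≟_) renaming (zero to fzero; suc to fsuc)
open import Data.Fin.Properties using (all?)
open import Data.Fin.Subset
  using (Subset; _⊆_; _∩_; ∁; ∣_∣; ⁅_⁆; ⊥; inside; outside)
open import Data.Fin.Subset.Properties
  using (_∈?_; _⊆?_; anySubset?; p∩q⊆p; p∩q⊆q; x∈p∩q⁺; x∉p⇒x∈∁p; x∈∁p⇒x∉p; x∈⁅x⁆; ∉⊥; p⊆q⇒∣p∣≤∣q∣)
open import Data.Vec using ([]; _∷_; here; there)
open import Data.Maybe using (Maybe; just; nothing)
open import Data.Product using (Σ; ∃; _×_; _,_)
open import Data.Unit using (tt)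
open import Data.Empty using (⊥-elim)
open import Function using (id; _on_)
open import Induction.WellFounded using (Acc; acc)
import Relation.Binary.Construct.On as On
open import Relation.Binary.PropositionalEquality using (_≡_; refl; subst; cong)
open import Relation.Nullary using (Dec; yes; no)
open import Relation.Nullary.Decidable using (_×-dec_; _→-dec_; ¬?; decidable-stable)
open import Relation.Unary using (Pred; Decidable)

allSubset? : ∀ {n ℓ} {P : Pred (Subset n) ℓ} → Decidable P → Dec (∀ p → P p)
allSubset? {P = P} P? with anySubset? (λ p → ¬? (P? p))
... | yes (p , ¬Pp) = no λ ∀P → ¬Pp (∀P p)
... | no ∄¬P        = yes λ p → decidable-stable (P? p) (λ ¬Pp → ∄¬P (p , ¬Pp))

module _ {n ℓ} {P : Pred (Subset n) ℓ} (P? : Decidable P) where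

  ∃-minimum-∣∣ : ∀ {p} → P p → ∃ λ p₀ → P p₀ × (∀ q → P q → ∣ p₀ ∣ ≤ ∣ q ∣)
  ∃-minimum-∣∣ = go (On.wellFounded ∣_∣ <-wellFounded _)
    where
    go : ∀ {p} → Acc (_<_ on ∣_∣) p → P p → ∃ λ p₀ → P p₀ × (∀ q → P q → ∣ p₀ ∣ ≤ ∣ q ∣)
    go {p} (acc rs) Pp with anySubset? (λ q → P? q ×-dec (∣ q ∣ <? ∣ p ∣))
    ... | yes (q , Pq , smaller) = go (rs smaller) Pq
    ... | no ∄smaller = p , Pp , λ q Pq → ℕ.≮⇒≥ (λ smaller → ∄smaller (q , Pq , smaller))

∃-⊆-of-size : ∀ {n} (p : Subset n) b → b ≤ ∣ p ∣ → ∃ λ q → q ⊆ p × ∣ q ∣ ≡ b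
∃-⊆-of-size [] zero _ = [] , id , refl
∃-⊆-of-size (outside ∷ p) b b≤ with ∃-⊆-of-size p b b≤
... | q , q⊆p , ∣q∣≡b = outside ∷ q , (λ { (there x∈q) → there (q⊆p x∈q) }) , ∣q∣≡b
∃-⊆-of-size (inside ∷ p) zero _ with ∃-⊆-of-size p zero z≤n
... | q , q⊆p , ∣q∣≡0 = outside ∷ q , (λ { (there x∈q) → there (q⊆p x∈q) }) , ∣q∣≡0
∃-⊆-of-size (inside ∷ p) (suc b) (s≤s b≤) with ∃-⊆-of-size p b b≤
... | q , q⊆p , ∣q∣≡b =
  inside ∷ q , (λ { here → here ; (there x∈q) → there (q⊆p x∈q) }) , cong suc ∣q∣≡b

∣p∣≤∣p∩∁⊥∣ : ∀ {n} (p : Subset n) → ∣ p ∣ ≤ ∣ p ∩ ∁ ⊥ ∣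
∣p∣≤∣p∩∁⊥∣ p = p⊆q⇒∣p∣≤∣q∣ {p = p} {q = p ∩ ∁ ⊥} (λ x∈p → x∈p∩q⁺ (x∈p , x∉p⇒x∈∁p ∉⊥))

∣p∣≤1+∣p∩∁⁅x⁆∣ : ∀ {n} (p : Subset n) x → ∣ p ∣ ≤ suc ∣ p ∩ ∁ ⁅ x ⁆ ∣
∣p∣≤1+∣p∩∁⁅x⁆∣ (outside ∷ p) fzero    = ℕ.m≤n⇒m≤1+n (∣p∣≤∣p∩∁⊥∣ p)
∣p∣≤1+∣p∩∁⁅x⁆∣ (inside ∷ p)  fzero    = s≤s (∣p∣≤∣p∩∁⊥∣ p)
∣p∣≤1+∣p∩∁⁅x⁆∣ (outside ∷ p) (fsuc x) = ∣p∣≤1+∣p∩∁⁅x⁆∣ p x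
∣p∣≤1+∣p∩∁⁅x⁆∣ (inside ∷ p)  (fsuc x) = s≤s (∣p∣≤1+∣p∩∁⁅x⁆∣ p x)

_≥∞?_ : ∀ m t → Dec (m ≥∞ t)
m ≥∞? fin z = z ℤ.≤? ℤ.+ m
m ≥∞? ∞     = no λ ()

_≼_ : ∀ {n} → (Fin n → ℤ∞) → (Fin n → ℤ∞) → Set
τ′ ≼ τ = ∀ m v → m ≥∞ τ v → m ≥∞ τ′ v

≥∞-dec∞ : ∀ m t → m ≥∞ t → m ≥∞ dec∞ t
≥∞-dec∞ m (fin z) m≥z = ℤ.i≤j⇒i-k≤j (ℤ.+ 1) m≥z

lower-≼ : ∀ {n} (τ : Fin n → ℤ∞) u → lower τ u ≼ τ
lower-≼ τ u m v with v ≟ u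
... | yes _ = ≥∞-dec∞ m (τ v)
... | no _  = id

module _ {n : ℕ} (adj : Fin n → Fin n → Bool) where

  isClosed? : ∀ S τ D H → Dec (IsClosed adj S τ D H)
  isClosed? S τ D H = (H ⊆? S) ×-dec ((D ⊆? H) ×-dec
    all? (λ v → (v ∈? S) →-dec ((∣ H ∩ (N adj v ∩ S) ∣ ≥∞? τ v) →-dec (v ∈? H))))

  inHull? : ∀ S τ D v → Dec (InHull adj S τ D v)
  inHull? S τ D v = (v ∈? S) ×-dec allSubset? (λ H → isClosed? S τ D H →-dec (v ∈? H))

  isDynMonopoly? : ∀ S τ D → Dec (IsDynMonopoly adj S τ D)
  isDynMonopoly? S τ D = (D ⊆? S) ×-dec all? (λ v → (v ∈? S) →-dec inHull? S τ D v)

  isDynMonopoly-self : ∀ S τ → IsDynMonopoly adj S τ S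
  isDynMonopoly-self S τ = id , λ v v∈S → v∈S , λ H (_ , S⊆H , _) → S⊆H v∈S

  ∃-dyn : ∀ S τ → ∃ (IsDyn adj S τ)
  ∃-dyn S τ with ∃-minimum-∣∣ (isDynMonopoly? S τ) (isDynMonopoly-self S τ)
  ... | D , isMono , minimal = ∣ D ∣ , (D , isMono , refl) , minimal

  module _ {τ′ τ : Fin n → ℤ∞} (τ′≼τ : τ′ ≼ τ) where

    isClosed-≼ : ∀ {S D H} → IsClosed adj S τ′ D H → IsClosed adj S τ D H
    isClosed-≼ (H⊆S , D⊆H , closed) = H⊆S , D⊆H , λ v v∈S enough → closed v v∈S (τ′≼τ _ v enough)

    isDynMonopoly-≼ : ∀ {S D} → IsDynMonopoly adj S τ D → IsDynMonopoly adj S τ′ D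
    isDynMonopoly-≼ (D⊆S , spans) = D⊆S , λ v v∈S →
      let v∈S′ , v∈closed = spans v v∈S in v∈S′ , λ H isClosed → v∈closed H (isClosed-≼ isClosed)

    dyn-≼ : ∀ {S k k′} → IsDyn adj S τ k → IsDyn adj S τ′ k′ → k′ ≤ k
    dyn-≼ ((D , isMono , refl) , _) (_ , minimal′) = minimal′ D (isDynMonopoly-≼ isMono)

  module _ {Su : Subset n} {u : Fin n} {b : ℕ} where

    ∃-admissible : b ≤ ∣ Su ∣ ∸ 1 → ∃ (Admissible adj Su u b)
    ∃-admissible b≤ with ∃-⊆-of-size (Su ∩ ∁ ⁅ u ⁆) b (ℕ.≤-trans b≤ (ℕ.∸-monoˡ-≤ 1 (∣p∣≤1+∣p∩∁⁅x⁆∣ Su u)))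
    ... | Y , Y⊆ , ∣Y∣≡b = Y , (λ y∈Y → p∩q⊆p Su _ (Y⊆ y∈Y)) , ∣Y∣≡b ,
                           λ u∈Y → x∈∁p⇒x∉p (p∩q⊆q Su _ (Y⊆ u∈Y)) (x∈⁅x⁆ u)

    module _ {τ′ τ : Fin n → ℤ∞} (τ′≼τ : τ′ ≼ τ) where

      yMax-≼ : ∀ {y y′} → IsYMax adj Su u b τ y → IsYMax adj Su u b τ′ y′ → y′ ≤⊥ y
      yMax-≼ {y′ = nothing} _ _ = tt
      yMax-≼ {nothing} {just _} ∄Y ((Y , adm , _) , _) = ∄Y Y adm
      yMax-≼ {just _} {just _} (_ , maximal) ((Y , adm , dyn′) , _) =
        let k , dyn = ∃-dyn (Su ∩ ∁ Y) τ in ℕ.≤-trans (dyn-≼ τ′≼τ dyn dyn′) (maximal Y k adm dyn)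

      yMax-common-maximiser : ∀ {m} → IsYMax adj Su u b τ (just m) → IsYMax adj Su u b τ′ (just m) →
        ∃ λ Y → Admissible adj Su u b Y × IsDyn adj (Su ∩ ∁ Y) τ m × IsDyn adj (Su ∩ ∁ Y) τ′ m
      yMax-common-maximiser (_ , maximal) ((Y , adm , dyn′) , _) =
        let k , dyn = ∃-dyn (Su ∩ ∁ Y) τ
            k≡m = ℕ.≤-antisym (maximal Y k adm dyn) (dyn-≼ τ′≼τ dyn dyn′)
        in Y , adm , subst (IsDyn adj (Su ∩ ∁ Y) τ) k≡m dyn , dyn′

lemma7 : {n : ℕ} (adj : Fin n → Fin n → Bool) → IsTree adj →
    (r : Fin n) (τ : Fin n → ℤ∞) (u : Fin n) (b : ℕ) (Su : Subset n) →
    IsSubtreeVertexSet adj r u Su →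
    (y₀ y₁ : Maybe ℕ) →
    IsYMax adj Su u b τ y₀ → IsYMax adj Su u b (lower τ u) y₁ →
    (y₁ ≤⊥ y₀)
    × (y₀ ≡ y₁ → b ≤ ∣ Su ∣ ∸ 1 →
       ∃ λ Y → Admissible adj Su u b Y ×
         Σ ℕ (λ m₀ → Σ ℕ (λ m₁ → y₀ ≡ just m₀ × y₁ ≡ just m₁ ×
           IsDyn adj (Su ∩ ∁ Y) τ m₀ × IsDyn adj (Su ∩ ∁ Y) (lower τ u) m₁)))
lemma7 adj _ _ τ u b Su _ y₀ y₁ isMax₀ isMax₁ =
  yMax-≼ adj (lower-≼ τ u) isMax₀ isMax₁ , attained y₀ y₁ isMax₀ isMax₁
  where
  attained : ∀ y₀ y₁ → IsYMax adj Su u b τ y₀ → IsYMax adj Su u b (lower τ u) y₁ →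
    y₀ ≡ y₁ → b ≤ ∣ Su ∣ ∸ 1 →
    ∃ λ Y → Admissible adj Su u b Y ×
      Σ ℕ (λ m₀ → Σ ℕ (λ m₁ → y₀ ≡ just m₀ × y₁ ≡ just m₁ ×
        IsDyn adj (Su ∩ ∁ Y) τ m₀ × IsDyn adj (Su ∩ ∁ Y) (lower τ u) m₁))
  attained nothing .nothing ∄Y _ refl b≤ =
    let Y , adm = ∃-admissible adj b≤ in ⊥-elim (∄Y Y adm)
  attained (just m) .(just m) isMax₀ isMax₁ refl _ =
    let Y , adm , dyn₀ , dyn₁ = yMax-common-maximiser adj (lower-≼ τ u) isMax₀ isMax₁
    in Y , adm , m , m , refl , refl , dyn₀ , dyn₁
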